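{- Let $q$ be a prime power and $a,n$ integers with $a \ge 1$ and $n \ge 2a+1$. Then $\mathcal{A}_q\left(n,n-a,n-2a;q^{a^2}\right) \ge q^{a(n-a)}$.
   Context: A $t$-$(n,k,\lambda)_q$ subspace packing is a collection of $k$-dimensional subspaces (blocks) of $\mathbb{F}_q^n$ such that every $t$-dimensional subspace of $\mathbb{F}_q^n$ is contained in at most $\lambda$ blocks. $\mathcal{A}_q(n,k,t;\lambda)$ denotes the maximum number of blocks of such a packing without repeated blocks (i.e., the blocks form a set). -}

module Defs where

open import Level using (Level; _⊔_) renaming (suc to lsuc)
open import Algebra.Bundles using (CommutativeRing)
open import Data.Nat using (ℕ; zero) renaming (suc to sucℕ)
open import Data.Fin using (Fin; zero; suc)
open import Data.Product using (Σ; ∃; _×_)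
open import Relation.Nullary using (¬_)
open import Relation.Binary.PropositionalEquality using (_≡_)

record IsFieldRing {c ℓ : Level} (R : CommutativeRing c ℓ) : Set (c ⊔ ℓ) where
  open CommutativeRing R
  field
    1≉0     : ¬ (1# ≈ 0#)
    inverse : ∀ x → ¬ (x ≈ 0#) → Σ Carrier λ y → (x * y) ≈ 1#

-- A finite field with exactly q elements (counted up to the field's
-- equality ≈): an enumeration Fin q → Carrier that is injective and
-- surjective with respect to ≈.
record FiniteField (c ℓ : Level) (q : ℕ) : Set (lsuc (c ⊔ ℓ)) where
  field
    cring   : CommutativeRing c ℓ
    isField : IsFieldRing cring
  open CommutativeRing cring public
  field
    enum       : Fin q → Carrier
    enum-inj   : ∀ i j → enum i ≈ enum j → i ≡ j
    enum-surj  : ∀ x → Σ (Fin q) λ i → enum i ≈ x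

module LinAlg {c ℓ : Level} {q : ℕ} (F : FiniteField c ℓ q) where
  open FiniteField F using (Carrier; _≈_; _+_; _*_; 0#)

  Vec : ℕ → Set c
  Vec n = Fin n → Carrier

  Σ[_] : ∀ {k} → (Fin k → Carrier) → Carrier
  Σ[_] {zero}   f = 0#
  Σ[_] {sucℕ k} f = f zero + Σ[ (λ i → f (suc i)) ]

  lincomb : ∀ {k n} → (Fin k → Carrier) → (Fin k → Vec n) → Vec n
  lincomb cs vs j = Σ[ (λ i → cs i * vs i j) ]

  LinearlyIndependent : ∀ {k n} → (Fin k → Vec n) → Set (c ⊔ ℓ)
  LinearlyIndependent {k} {n} vs =
    ∀ (cs : Fin k → Carrier) → (∀ j → lincomb cs vs j ≈ 0#) → ∀ i → cs i ≈ 0#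

  record Subspace (n k : ℕ) : Set (c ⊔ ℓ) where
    field
      basis : Fin k → Vec n
      indep : LinearlyIndependent basis

  _∈ₛ_ : ∀ {n k} → Vec n → Subspace n k → Set (c ⊔ ℓ)
  _∈ₛ_ {n} {k} x U =
    Σ (Fin k → Carrier) λ cs → ∀ j → x j ≈ lincomb cs (Subspace.basis U) j

  _⊆ₛ_ : ∀ {n k m} → Subspace n k → Subspace n m → Set (c ⊔ ℓ)
  _⊆ₛ_ {n} U W = ∀ (x : Vec n) → x ∈ₛ U → x ∈ₛ W

  _≡ₛ_ : ∀ {n k m} → Subspace n k → Subspace n m → Set (c ⊔ ℓ)
  U ≡ₛ W = (U ⊆ₛ W) × (W ⊆ₛ U)

  -- A t-(n,k,λ)_q subspace packing without repeated blocks, with m blocks: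
  -- pairwise distinct k-subspaces B 0 … B (m-1), such that no t-subspace
  -- is contained in λ+1 distinct blocks (i.e. each is in at most λ blocks).
  record Packing (n k t lam m : ℕ) : Set (c ⊔ ℓ) where
    field
      block    : Fin m → Subspace n k
      distinct : ∀ i j → block i ≡ₛ block j → i ≡ j
      packing  : ∀ (T : Subspace n t) (f : Fin (sucℕ lam) → Fin m) →
                 (∀ i j → f i ≡ f j → i ≡ j) →
                 ¬ (∀ i → T ⊆ₛ block (f i))

-- Write n = N + a with N = k + a, k = n - 2a.  For every matrix A ∈ F^(N×a)
-- the row space of [ I_N | A ] is an N-dimensional subspace of F^n; these
-- q^(aN) blocks are pairwise distinct because A can be read off from the
-- block.  If a k-dimensional subspace T lies in the block of A, then writing
-- the basis vectors of T as [ X | Y ] we get X·A = Y with X of full rank k.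
-- Each column of A is thus a solution of a linear system with k independent
-- equations in N unknowns, of which there are at most q^(N-k) = q^a.
module Submission where

open import Defs
open import Level using (Level; _⊔_)
open import Data.Nat as ℕ using (ℕ; suc; zero)
import Data.Nat.Properties as ℕP
open import Data.Fin as Fin using (Fin; zero; suc; punchIn; _↑ˡ_; _↑ʳ_; splitAt; combine; remQuot; finToFun; funToFin)
open import Data.Fin.Properties using (_≟_; join-splitAt; combine-remQuot; funToFin-finToFin; finToFun-funToFin; injective⇒≤; nonZeroIndex)
open import Data.Product using (Σ; _×_; _,_; proj₁; proj₂)
open import Data.Sum using (_⊎_; inj₁; inj₂; [_,_])
open import Data.Empty using (⊥-elim)
open import Relation.Nullary using (¬_; Dec; yes; no)
open import Relation.Binary.PropositionalEquality as P using (_≡_)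
open import Data.Vec.Functional using (_∷_; _++_; insertAt; tail)
open import Data.Vec.Functional.Properties using (lookup-++ˡ; lookup-++ʳ; insertAt-punchIn; insertAt-lookup)

module Arithmetic where
  open import Data.Nat using (_+_; _*_; _^_; _≤_; _<_)

  power-split : ∀ q k a → (q ^ (k + a)) ^ a ≡ q ^ (a * a) * (q ^ k) ^ a
  power-split q k a = begin
    (q ^ (k + a)) ^ a          ≡⟨ ℕP.^-*-assoc q (k + a) a ⟩
    q ^ ((k + a) * a)          ≡⟨ P.cong (q ^_) (ℕP.*-distribʳ-+ a k a) ⟩
    q ^ (k * a + a * a)        ≡⟨ ℕP.^-distribˡ-+-* q (k * a) (a * a) ⟩
    q ^ (k * a) * q ^ (a * a)  ≡⟨ P.cong (_* q ^ (a * a)) (P.sym (ℕP.^-*-assoc q k a)) ⟩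
    (q ^ k) ^ a * q ^ (a * a)  ≡⟨ ℕP.*-comm ((q ^ k) ^ a) (q ^ (a * a)) ⟩
    q ^ (a * a) * (q ^ k) ^ a  ∎
    where open P.≡-Reasoning

  successor-copies-too-many : ∀ lam Q → 0 < Q → ¬ (suc lam * Q ≤ lam * Q)
  successor-copies-too-many lam Q Q>0 = ℕP.<⇒≱ (ℕP.m<n+m (lam * Q) Q>0)

open Arithmetic

++-index-elim : ∀ {m n ℓ'} {Q : Fin (m ℕ.+ n) → Set ℓ'} →
  (∀ s → Q (s ↑ˡ n)) → (∀ l → Q (m ↑ʳ l)) → ∀ j → Q j
++-index-elim {m} {n} {Q = Q} left right j =
  P.subst Q (join-splitAt m n j) ([_,_] {C = λ s → Q (Fin.join m n s)} left right (splitAt m j))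

funToFin-cong : ∀ {m n} (f g : Fin m → Fin n) → (∀ z → f z ≡ g z) → funToFin f ≡ funToFin g
funToFin-cong {zero}  f g f≗g = P.refl
funToFin-cong {suc m} f g f≗g =
  P.cong₂ combine (f≗g zero) (funToFin-cong (λ z → f (suc z)) (λ z → g (suc z)) (λ z → f≗g (suc z)))

finToFun-injective : ∀ {m n} (b b' : Fin (m ℕ.^ n)) →
  (∀ z → finToFun {m} {n} b z ≡ finToFun b' z) → b ≡ b'
finToFun-injective {m} {n} b b' same = begin
  b                               ≡⟨ P.sym (funToFin-finToFin {n} {m} b) ⟩
  funToFin (finToFun {m} {n} b)   ≡⟨ funToFin-cong (finToFun b) (finToFun b') same ⟩
  funToFin (finToFun {m} {n} b')  ≡⟨ funToFin-finToFin {n} {m} b' ⟩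
  b'                              ∎
  where open P.≡-Reasoning

funToFin-injective : ∀ {m n} (f g : Fin m → Fin n) → funToFin f ≡ funToFin g → ∀ z → f z ≡ g z
funToFin-injective f g same z = begin
  f z                        ≡⟨ P.sym (finToFun-funToFin f z) ⟩
  finToFun (funToFin f) z    ≡⟨ P.cong (λ t → finToFun t z) same ⟩
  finToFun (funToFin g) z    ≡⟨ finToFun-funToFin g z ⟩
  g z                        ∎
  where open P.≡-Reasoning

Packing-cong : ∀ {c ℓ q} (F : FiniteField c ℓ q) {n n' k k' t t' lam m} →
  n ≡ n' → k ≡ k' → t ≡ t' →
  LinAlg.Packing F n k t lam m → LinAlg.Packing F n' k' t' lam m
Packing-cong F P.refl P.refl P.refl packing = packing

module OverField {c ℓ : Level} {q : ℕ} (F : FiniteField c ℓ q) where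
  open FiniteField F hiding (zero)
  open LinAlg F
  open IsFieldRing isField
  open import Relation.Binary.Reasoning.Setoid setoid
  open import Data.Vec.Functional.Relation.Binary.Equality.Setoid setoid using (_≋_)
  open import Algebra.Properties.Semiring.Sum semiring using (sum; sum-cong-≋; sum-replicate-zero; sum-remove; ∑-distrib-+; ∑-comm; *-distribˡ-sum; *-distribʳ-sum)
  open import Algebra.Properties.Group +-group using (∙-cancelʳ)
  open import Algebra.Properties.Ring ring using (-‿distribˡ-*)
  open import Algebra.Solver.Ring.NaturalCoefficients.Default commutativeSemiring using (solve; _:=_; _:+_; _:*_)

  -- Equality in F is decidable, by comparing indices in the enumeration.
  _≟F_ : ∀ x y → Dec (x ≈ y)
  x ≟F y with enum-surj x | enum-surj y
  ... | i , eᵢ | j , eⱼ with i ≟ j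
  ...   | yes P.refl = yes (trans (sym eᵢ) eⱼ)
  ...   | no i≢j     = no (λ x≈y → i≢j (enum-inj i j (trans eᵢ (trans x≈y (sym eⱼ)))))

  -- The sum Σ[_] of Defs is the library's finite sum (both are foldr); the
  -- standard summation identities below are transported along this.
  Σ≡sum : ∀ {k} (f : Fin k → Carrier) → Σ[ f ] ≡ sum f
  Σ≡sum {zero}  f = P.refl
  Σ≡sum {suc k} f = P.cong (f zero +_) (Σ≡sum (λ i → f (suc i)))

  Σ-as-sum : ∀ {k} {f g : Fin k → Carrier} → (∀ i → f i ≈ g i) → Σ[ f ] ≈ sum g
  Σ-as-sum {f = f} f≈g = trans (reflexive (Σ≡sum f)) (sum-cong-≋ f≈g)

  Σ-cong : ∀ {k} {f g : Fin k → Carrier} → (∀ i → f i ≈ g i) → Σ[ f ] ≈ Σ[ g ]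
  Σ-cong {g = g} f≈g = trans (Σ-as-sum f≈g) (reflexive (P.sym (Σ≡sum g)))

  Σ-0 : ∀ {k} {f : Fin k → Carrier} → (∀ i → f i ≈ 0#) → Σ[ f ] ≈ 0#
  Σ-0 {k} f≈0 = trans (Σ-cong f≈0) (trans (reflexive (Σ≡sum {k} (λ _ → 0#))) (sum-replicate-zero k))

  Σ-affine : ∀ {k} (f g : Fin k → Carrier) t → Σ[ (λ i → f i + g i * t) ] ≈ Σ[ f ] + Σ[ g ] * t
  Σ-affine f g t = begin
    Σ[ (λ i → f i + g i * t) ]        ≡⟨ Σ≡sum (λ i → f i + g i * t) ⟩
    sum (λ i → f i + g i * t)         ≈⟨ ∑-distrib-+ f (λ i → g i * t) ⟩
    sum f + sum (λ i → g i * t)       ≈⟨ +-congˡ (sym (*-distribʳ-sum t g)) ⟩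
    sum f + sum g * t                 ≡⟨ P.cong₂ (λ u v → u + v * t) (Σ≡sum f) (Σ≡sum g) ⟨
    Σ[ f ] + Σ[ g ] * t               ∎

  Σ-*ˡ : ∀ {k} x (f : Fin k → Carrier) → x * Σ[ f ] ≈ Σ[ (λ i → x * f i) ]
  Σ-*ˡ x f = begin
    x * Σ[ f ]                ≡⟨ P.cong (x *_) (Σ≡sum f) ⟩
    x * sum f                 ≈⟨ *-distribˡ-sum x f ⟩
    sum (λ i → x * f i)       ≡⟨ Σ≡sum (λ i → x * f i) ⟨
    Σ[ (λ i → x * f i) ]      ∎

  Σ-*ʳ : ∀ {k} x (f : Fin k → Carrier) → Σ[ f ] * x ≈ Σ[ (λ i → f i * x) ]
  Σ-*ʳ x f = begin
    Σ[ f ] * x                ≡⟨ P.cong (_* x) (Σ≡sum f) ⟩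
    sum f * x                 ≈⟨ *-distribʳ-sum x f ⟩
    sum (λ i → f i * x)       ≡⟨ Σ≡sum (λ i → f i * x) ⟨
    Σ[ (λ i → f i * x) ]      ∎

  Σ-swap : ∀ {k m} (f : Fin k → Fin m → Carrier) →
    Σ[ (λ i → Σ[ (λ j → f i j) ]) ] ≈ Σ[ (λ j → Σ[ (λ i → f i j) ]) ]
  Σ-swap f = begin
    Σ[ (λ i → Σ[ (λ j → f i j) ]) ]  ≈⟨ Σ-as-sum (λ i → reflexive (Σ≡sum (f i))) ⟩
    sum (λ i → sum (λ j → f i j))    ≈⟨ ∑-comm f ⟩
    sum (λ j → sum (λ i → f i j))    ≈⟨ Σ-as-sum (λ j → reflexive (Σ≡sum (λ i → f i j))) ⟨
    Σ[ (λ j → Σ[ (λ i → f i j) ]) ]  ∎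

  δ : ∀ {N} → Fin N → Fin N → Carrier
  δ zero    zero    = 1#
  δ zero    (suc j) = 0#
  δ (suc i) zero    = 0#
  δ (suc i) (suc j) = δ i j

  δ-sym : ∀ {N} (i j : Fin N) → δ i j ≡ δ j i
  δ-sym zero    zero    = P.refl
  δ-sym zero    (suc j) = P.refl
  δ-sym (suc i) zero    = P.refl
  δ-sym (suc i) (suc j) = δ-sym i j

  Σ-δʳ : ∀ {N} (cs : Fin N → Carrier) j → Σ[ (λ i → cs i * δ i j) ] ≈ cs j
  Σ-δʳ {suc N} cs zero = begin
    cs zero * 1# + Σ[ (λ i → cs (suc i) * 0#) ] ≈⟨ +-cong (*-identityʳ _) (Σ-0 (λ i → zeroʳ (cs (suc i)))) ⟩
    cs zero + 0#                                 ≈⟨ +-identityʳ _ ⟩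
    cs zero                                      ∎
  Σ-δʳ {suc N} cs (suc j) = begin
    cs zero * 0# + Σ[ (λ i → cs (suc i) * δ i j) ] ≈⟨ +-cong (zeroʳ _) (Σ-δʳ (λ i → cs (suc i)) j) ⟩
    0# + cs (suc j)                                ≈⟨ +-identityˡ _ ⟩
    cs (suc j)                                     ∎

  Σ-δˡ : ∀ {N} r (g : Fin N → Carrier) → Σ[ (λ i → δ r i * g i) ] ≈ g r
  Σ-δˡ r g = trans (Σ-cong (λ i → trans (*-comm _ _) (*-congˡ (reflexive (δ-sym r i))))) (Σ-δʳ g r)

  unit-cancelˡ : ∀ B w u u' → B * w ≈ 1# → B * u ≈ B * u' → u ≈ u'
  unit-cancelˡ B w u u' Bw≈1 Bu≈Bu' = begin
    u             ≈⟨ *-identityˡ u ⟨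
    1# * u        ≈⟨ *-congʳ Bw≈1 ⟨
    (B * w) * u   ≈⟨ solve 3 (λ B w u → (B :* w) :* u := w :* (B :* u)) refl B w u ⟩
    w * (B * u)   ≈⟨ *-congˡ Bu≈Bu' ⟩
    w * (B * u')  ≈⟨ solve 3 (λ B w u → w :* (B :* u) := (B :* w) :* u) refl B w u' ⟩
    (B * w) * u'  ≈⟨ *-congʳ Bw≈1 ⟩
    1# * u'       ≈⟨ *-identityˡ u' ⟩
    u'            ∎

  clear-entry : ∀ a B w → B * w ≈ 1# → a + (- (a * w)) * B ≈ 0#
  clear-entry a B w Bw≈1 = begin
    a + (- (a * w)) * B  ≈⟨ +-congˡ (-‿distribˡ-* (a * w) B) ⟨
    a + - ((a * w) * B)  ≈⟨ +-congˡ (-‿cong (solve 3 (λ a B w → (a :* w) :* B := a :* (B :* w)) refl a B w)) ⟩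
    a + - (a * (B * w))  ≈⟨ +-congˡ (-‿cong (trans (*-congˡ Bw≈1) (*-identityʳ a))) ⟩
    a + - a              ≈⟨ -‿inverseʳ a ⟩
    0#                   ∎

  find-nonzero : ∀ {k} (g : Vec k) → (Σ (Fin k) λ p → ¬ (g p ≈ 0#)) ⊎ (∀ i → g i ≈ 0#)
  find-nonzero {zero} g = inj₂ (λ ())
  find-nonzero {suc k} g with g zero ≟F 0#
  ... | no g₀≉0 = inj₁ (zero , g₀≉0)
  ... | yes g₀≈0 with find-nonzero (tail g)
  ...   | inj₁ (p , gₚ≉0) = inj₁ (suc p , gₚ≉0)
  ...   | inj₂ g≈0        = inj₂ λ { zero → g₀≈0 ; (suc i) → g≈0 i }

  dot : ∀ {N} → Vec N → Vec N → Carrier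
  dot u v = Σ[ (λ j → u j * v j) ]

  dot-affine : ∀ {N} (u w v : Vec N) r → dot (λ j → u j + r * w j) v ≈ dot u v + r * dot w v
  dot-affine u w v r = begin
    Σ[ (λ j → (u j + r * w j) * v j) ]   ≈⟨ Σ-cong (λ j → solve 4 (λ u w v r → (u :+ r :* w) :* v := u :* v :+ (w :* v) :* r) refl (u j) (w j) (v j) r) ⟩
    Σ[ (λ j → u j * v j + (w j * v j) * r) ] ≈⟨ Σ-affine (λ j → u j * v j) (λ j → w j * v j) r ⟩
    dot u v + dot w v * r                ≈⟨ +-congˡ (*-comm _ r) ⟩
    dot u v + r * dot w v                ∎

  dot-zero-head : ∀ {N} (u v : Vec (suc N)) → u zero ≈ 0# → dot u v ≈ dot (tail u) (tail v)
  dot-zero-head u v u₀≈0 = trans (+-congʳ (trans (*-congʳ u₀≈0) (zeroˡ _))) (+-identityˡ _)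

  Σ-scaled-affine : ∀ {k} (cs a ρ : Fin k → Carrier) b →
    Σ[ (λ i → cs i * (a i + ρ i * b)) ] ≈ Σ[ (λ i → cs i * a i) ] + Σ[ (λ i → cs i * ρ i) ] * b
  Σ-scaled-affine cs a ρ b = trans
    (Σ-cong (λ i → solve 4 (λ c a ρ b → c :* (a :+ ρ :* b) := c :* a :+ (c :* ρ) :* b) refl (cs i) (a i) (ρ i) b))
    (Σ-affine (λ i → cs i * a i) (λ i → cs i * ρ i) b)

  Solves : ∀ {N k} → (Fin k → Vec N) → Vec k → Vec N → Set ℓ
  Solves x y v = ∀ i → dot (x i) v ≈ y i

  -- The solution bound |Sol(x, y)| · q^k ≤ q^N, in injective form: a map that
  -- overwrites k coordinates of a solution by arbitrary values and is
  -- injective on Sol(x, y) × F^k for every right-hand side y.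
  record FreeCoordinates {N k} (x : Fin k → Vec N) : Set (c ⊔ ℓ) where
    field
      fill : Vec N → Vec k → Vec N
      fill-injective : ∀ {y v v' cs cs'} → Solves x y v → Solves x y v' →
        fill v cs ≋ fill v' cs' → (v ≋ v') × (cs ≋ cs')

  -- Elimination step when the first column of x vanishes: drop it.
  module ZeroColumn {N k} (x : Fin k → Vec (suc N)) (x₀≈0 : ∀ i → x i zero ≈ 0#) where
    rest : Fin k → Vec N
    rest i = tail (x i)

    rest-independent : LinearlyIndependent x → LinearlyIndependent rest
    rest-independent x-indep cs rest-relation = x-indep cs relation
      where
      relation : ∀ j → lincomb cs x j ≈ 0#
      relation zero    = Σ-0 (λ i → trans (*-congˡ (x₀≈0 i)) (zeroʳ (cs i)))
      relation (suc j) = rest-relation j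

    rest-solves : ∀ {y v} → Solves x y v → Solves rest y (tail v)
    rest-solves {y} {v} solves i = trans (sym (dot-zero-head (x i) v (x₀≈0 i))) (solves i)

    -- The first coordinate is unconstrained, so it is kept as it is.
    lift : FreeCoordinates rest → FreeCoordinates x
    lift free = record { fill = fill ; fill-injective = fill-injective }
      where
      module R = FreeCoordinates free
      fill : Vec (suc N) → Vec k → Vec (suc N)
      fill v cs = v zero ∷ R.fill (tail v) cs
      fill-injective : ∀ {y v v' cs cs'} → Solves x y v → Solves x y v' →
        fill v cs ≋ fill v' cs' → (v ≋ v') × (cs ≋ cs')
      fill-injective {y} {v} {v'} s s' same
        with R.fill-injective (rest-solves {y} {v} s) (rest-solves {y} {v'} s') (λ j → same (suc j))
      ... | tails , cs≈cs' = (λ { zero → same zero ; (suc j) → tails j }) , cs≈cs'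

  -- Elimination step with pivot x p 0 (inverse w): subtract multiples of row p
  -- from the other rows to clear the first column, then drop that column.
  module Pivot {N k} (x : Fin (suc k) → Vec (suc N)) (p : Fin (suc k))
               (w : Carrier) (pivot : x p zero * w ≈ 1#) where
    ρ : Fin k → Carrier
    ρ i = - (x (punchIn p i) zero * w)

    combined : Fin k → Vec (suc N)
    combined i j = x (punchIn p i) j + ρ i * x p j

    combined-cleared : ∀ i → combined i zero ≈ 0#
    combined-cleared i = clear-entry (x (punchIn p i) zero) (x p zero) w pivot

    reduced : Fin k → Vec N
    reduced i = tail (combined i)

    reduced-rhs : Vec (suc k) → Vec k
    reduced-rhs y i = y (punchIn p i) + ρ i * y p

    reduced-independent : LinearlyIndependent x → LinearlyIndependent reduced
    reduced-independent x-indep cs reduced-relation i =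
      trans (sym (reflexive (insertAt-punchIn cs p δₚ i))) (x-indep ds relation (punchIn p i))
      where
      δₚ : Carrier
      δₚ = Σ[ (λ i → cs i * ρ i) ]
      ds : Vec (suc k)
      ds = insertAt cs p δₚ
      -- A relation cs among the reduced rows is the relation ds = cs with the
      -- coefficient δₚ inserted at p among the rows of x.
      expand : ∀ j → lincomb ds x j ≈ Σ[ (λ i → cs i * combined i j) ]
      expand j = begin
        lincomb ds x j
          ≡⟨ Σ≡sum (λ l → ds l * x l j) ⟩
        sum (λ l → ds l * x l j)
          ≈⟨ sum-remove {i = p} (λ l → ds l * x l j) ⟩
        ds p * x p j + sum (λ i → ds (punchIn p i) * x (punchIn p i) j)
          ≈⟨ +-cong (*-congʳ (reflexive (P.sym (insertAt-lookup cs p δₚ))))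
                    (Σ-as-sum (λ i → *-congʳ (reflexive (P.sym (insertAt-punchIn cs p δₚ i))))) ⟨
        δₚ * x p j + Σ[ (λ i → cs i * x (punchIn p i) j) ]
          ≈⟨ +-comm _ _ ⟩
        Σ[ (λ i → cs i * x (punchIn p i) j) ] + δₚ * x p j
          ≈⟨ Σ-scaled-affine cs (λ i → x (punchIn p i) j) ρ (x p j) ⟨
        Σ[ (λ i → cs i * combined i j) ] ∎
      relation : ∀ j → lincomb ds x j ≈ 0#
      relation zero    = trans (expand zero) (Σ-0 (λ i → trans (*-congˡ (combined-cleared i)) (zeroʳ (cs i))))
      relation (suc j) = trans (expand (suc j)) (reduced-relation j)

    reduced-solves : ∀ {y v} → Solves x y v → Solves reduced (reduced-rhs y) (tail v)
    reduced-solves {y} {v} solves i = begin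
      dot (reduced i) (tail v)                         ≈⟨ dot-zero-head (combined i) v (combined-cleared i) ⟨
      dot (combined i) v                               ≈⟨ dot-affine (x (punchIn p i)) (x p) v (ρ i) ⟩
      dot (x (punchIn p i)) v + ρ i * dot (x p) v      ≈⟨ +-cong (solves (punchIn p i)) (*-congˡ (solves p)) ⟩
      reduced-rhs y i                                  ∎

    -- On solutions, the first coordinate is determined by the others via row p.
    head-determined : ∀ {y v v'} → Solves x y v → Solves x y v' →
      tail v ≋ tail v' → v zero ≈ v' zero
    head-determined {y} {v} {v'} s s' tails = unit-cancelˡ (x p zero) w (v zero) (v' zero) pivot
      (∙-cancelʳ (dot (tail (x p)) (tail v)) _ _ (begin
        x p zero * v zero + dot (tail (x p)) (tail v)    ≈⟨ trans (s p) (sym (s' p)) ⟩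
        x p zero * v' zero + dot (tail (x p)) (tail v')  ≈⟨ +-congˡ (Σ-cong (λ j → *-congˡ (tails j))) ⟨
        x p zero * v' zero + dot (tail (x p)) (tail v)   ∎))

    -- The pivot coordinate is the free slot taken by the first filled value.
    lift : FreeCoordinates reduced → FreeCoordinates x
    lift free = record { fill = fill ; fill-injective = fill-injective }
      where
      module R = FreeCoordinates free
      fill : Vec (suc N) → Vec (suc k) → Vec (suc N)
      fill v cs = cs zero ∷ R.fill (tail v) (tail cs)
      fill-injective : ∀ {y v v' cs cs'} → Solves x y v → Solves x y v' →
        fill v cs ≋ fill v' cs' → (v ≋ v') × (cs ≋ cs')
      fill-injective {y} {v} {v'} s s' same
        with R.fill-injective (reduced-solves {y} {v} s) (reduced-solves {y} {v'} s') (λ j → same (suc j))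
      ... | tails , css =
        (λ { zero → head-determined {y} {v} {v'} s s' tails ; (suc j) → tails j }) ,
        (λ { zero → same zero ; (suc i) → css i })

  -- Gaussian elimination: every independent system has free coordinates.
  free-coordinates : ∀ N k (x : Fin k → Vec N) → LinearlyIndependent x → FreeCoordinates x
  free-coordinates zero zero x _ = record
    { fill = λ v _ → v ; fill-injective = λ _ _ _ → (λ ()) , (λ ()) }
  free-coordinates zero (suc k) x x-indep = ⊥-elim (1≉0 (x-indep (λ _ → 1#) (λ ()) zero))
  free-coordinates (suc N) k x x-indep with find-nonzero (λ i → x i zero)
  ... | inj₂ x₀≈0 = ZeroColumn.lift x x₀≈0
        (free-coordinates N k _ (ZeroColumn.rest-independent x x₀≈0 x-indep))
  free-coordinates (suc N) (suc k) x x-indep | inj₁ (p , xₚ≉0) with inverse (x p zero) xₚ≉0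
  ... | w , pivot = Pivot.lift x p w pivot
        (free-coordinates N k _ (Pivot.reduced-independent x p w pivot x-indep))

  -- q ≠ 0, as F has the element 0#.
  instance
    q-nonzero : ℕ.NonZero q
    q-nonzero = nonZeroIndex (proj₁ (enum-surj 0#))

  Matrix : ℕ → ℕ → Set c
  Matrix N a = Fin a → Vec N

  _≈ₘ_ : ∀ {N a} → Matrix N a → Matrix N a → Set ℓ
  C ≈ₘ C' = ∀ l → C l ≋ C' l

  encode : ∀ {N a} → Matrix N a → Fin ((q ℕ.^ N) ℕ.^ a)
  encode C = funToFin (λ l → funToFin (λ s → proj₁ (enum-surj (C l s))))

  decode : ∀ {N a} → Fin ((q ℕ.^ N) ℕ.^ a) → Matrix N a
  decode {N} {a} z l s = enum (finToFun {q} {N} (finToFun {q ℕ.^ N} {a} z l) s)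

  encode-injective : ∀ {N a} {C C' : Matrix N a} → encode C ≡ encode C' → C ≈ₘ C'
  encode-injective {C = C} {C'} same l s = begin
    C l s                           ≈⟨ proj₂ (enum-surj (C l s)) ⟨
    enum (proj₁ (enum-surj (C l s))) ≡⟨ P.cong enum (funToFin-injective _ _ (funToFin-injective _ _ same l) s) ⟩
    enum (proj₁ (enum-surj (C' l s))) ≈⟨ proj₂ (enum-surj (C' l s)) ⟩
    C' l s                          ∎

  decode-injective : ∀ {N a} (z z' : Fin ((q ℕ.^ N) ℕ.^ a)) → decode z ≈ₘ decode z' → z ≡ z'
  decode-injective {N} {a} z z' same = finToFun-injective {q ℕ.^ N} {a} z z' (λ l →
    finToFun-injective {q} {N} _ _ (λ s → enum-inj _ _ (same l s)))

  count-injection : ∀ {m k N a} (g : Fin m → Matrix k a → Matrix N a) →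
    (∀ {i i' C C'} → g i C ≈ₘ g i' C' → (i ≡ i') × (C ≈ₘ C')) →
    m ℕ.* (q ℕ.^ k) ℕ.^ a ℕ.≤ (q ℕ.^ N) ℕ.^ a
  count-injection {m} {k} {N} {a} g g-injective = injective⇒≤ numbered-injective
    where
    Q : ℕ
    Q = (q ℕ.^ k) ℕ.^ a
    numbered : Fin (m ℕ.* Q) → Fin ((q ℕ.^ N) ℕ.^ a)
    numbered z = encode (g (proj₁ (remQuot {m} Q z)) (decode (proj₂ (remQuot {m} Q z))))
    numbered-injective : ∀ {z z'} → numbered z ≡ numbered z' → z ≡ z'
    numbered-injective {z} {z'} same with g-injective (encode-injective same)
    ... | i≡i' , C≈C' = P.trans (P.sym (combine-remQuot {m} Q z))
      (P.trans (P.cong₂ combine i≡i' (decode-injective _ _ C≈C')) (combine-remQuot {m} Q z'))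

  basis-member : ∀ {n m} (B : Subspace n m) r → Subspace.basis B r ∈ₛ B
  basis-member B r = δ r , (λ j → sym (Σ-δˡ r (λ i → Subspace.basis B i j)))

  -- The blocks: for a matrix A ∈ F^(N×a), the row space of [ I_N | A ] in F^(N+a).
  module Blocks (k a : ℕ) where
    N : ℕ
    N = k ℕ.+ a

    left : Vec (N ℕ.+ a) → Vec N
    left u s = u (s ↑ˡ a)

    row : Matrix N a → Fin N → Vec (N ℕ.+ a)
    row A r = δ r ++ (λ l → A l r)

    block : Matrix N a → Subspace (N ℕ.+ a) N
    block A = record { basis = row A ; indep = row-independent }
      where
      row-independent : LinearlyIndependent (row A)
      row-independent cs relation r = begin
        cs r                                       ≈⟨ Σ-δʳ cs r ⟨
        Σ[ (λ i → cs i * δ i r) ]                  ≈⟨ Σ-cong (λ i → *-congˡ (reflexive (lookup-++ˡ (δ i) _ r))) ⟨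
        lincomb cs (row A) (r ↑ˡ a)                ≈⟨ relation (r ↑ˡ a) ⟩
        0#                                         ∎

    block-coordinates : ∀ A (u : Vec (N ℕ.+ a)) → u ∈ₛ block A →
      ∀ l → u (N ↑ʳ l) ≈ dot (left u) (A l)
    block-coordinates A u (cs , u≈) l = begin
      u (N ↑ʳ l)                             ≈⟨ u≈ (N ↑ʳ l) ⟩
      Σ[ (λ r → cs r * row A r (N ↑ʳ l)) ]   ≈⟨ Σ-cong (λ r → *-cong (cs≈left r) (reflexive (lookup-++ʳ (δ r) _ l))) ⟩
      dot (left u) (A l)                     ∎
      where
      cs≈left : ∀ s → cs s ≈ left u s
      cs≈left s = sym (begin
        u (s ↑ˡ a)                              ≈⟨ u≈ (s ↑ˡ a) ⟩
        Σ[ (λ r → cs r * row A r (s ↑ˡ a)) ]    ≈⟨ Σ-cong (λ r → *-congˡ (reflexive (lookup-++ˡ (δ r) _ s))) ⟩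
        Σ[ (λ r → cs r * δ r s) ]               ≈⟨ Σ-δʳ cs s ⟩
        cs s                                    ∎)

    block-injective : ∀ A A' → block A ≡ₛ block A' → A ≈ₘ A'
    block-injective A A' (A⊆A' , _) l r = begin
      A l r                               ≡⟨ lookup-++ʳ (δ r) _ l ⟨
      row A r (N ↑ʳ l)                    ≈⟨ block-coordinates A' (row A r) (A⊆A' _ (basis-member (block A) r)) l ⟩
      dot (left (row A r)) (A' l)         ≈⟨ Σ-cong (λ s → *-congʳ (reflexive (lookup-++ˡ (δ r) _ s))) ⟩
      Σ[ (λ s → δ r s * A' l s) ]         ≈⟨ Σ-δˡ r (A' l) ⟩
      A' l r                              ∎

    -- Inside a block, a linear relation among the left parts of vectors
    -- holds for the whole vectors, since the right part is a linear image.
    relation-lifts : ∀ {m} A (u : Fin m → Vec (N ℕ.+ a)) → (∀ j → u j ∈ₛ block A) →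
      ∀ cs → (∀ s → lincomb cs u (s ↑ˡ a) ≈ 0#) → ∀ j → lincomb cs u j ≈ 0#
    relation-lifts A u u∈ cs left-relation =
      ++-index-elim {Q = λ j → lincomb cs u j ≈ 0#} left-relation right-relation
      where
      right-relation : ∀ l → lincomb cs u (N ↑ʳ l) ≈ 0#
      right-relation l = begin
        Σ[ (λ j → cs j * u j (N ↑ʳ l)) ]                   ≈⟨ Σ-cong (λ j → *-congˡ (block-coordinates A (u j) (u∈ j) l)) ⟩
        Σ[ (λ j → cs j * Σ[ (λ s → left (u j) s * A l s) ]) ]
          ≈⟨ Σ-cong (λ j → trans (Σ-*ˡ (cs j) (λ s → left (u j) s * A l s))
                               (Σ-cong (λ s → sym (*-assoc (cs j) (left (u j) s) (A l s))))) ⟩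
        Σ[ (λ j → Σ[ (λ s → (cs j * left (u j) s) * A l s) ]) ] ≈⟨ Σ-swap (λ j s → (cs j * left (u j) s) * A l s) ⟩
        Σ[ (λ s → Σ[ (λ j → (cs j * left (u j) s) * A l s) ]) ] ≈⟨ Σ-cong (λ s → Σ-*ʳ (A l s) (λ j → cs j * left (u j) s)) ⟨
        Σ[ (λ s → lincomb cs u (s ↑ˡ a) * A l s) ]          ≈⟨ Σ-0 (λ s → trans (*-congʳ (left-relation s)) (zeroˡ _)) ⟩
        0#                                                  ∎

    lam : ℕ
    lam = q ℕ.^ (a ℕ.* a)

    -- No k-dimensional subspace T lies in λ+1 distinct blocks: the columns
    -- of each of their matrices solve the system X·A = Y read off from T, so
    -- free coordinates give an injection Fin (λ+1) × F^(k×a) ↪ F^(N×a).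
    at-most-λ-blocks : (T : Subspace (N ℕ.+ a) k) (f : Fin (suc lam) → Fin ((q ℕ.^ N) ℕ.^ a)) →
      (∀ i j → f i ≡ f j → i ≡ j) → ¬ (∀ i → T ⊆ₛ block (decode (f i)))
    at-most-λ-blocks T f f-injective T⊆ =
      successor-copies-too-many lam Q Q>0 (P.subst (suc lam ℕ.* Q ℕ.≤_) (power-split q k a) too-many)
      where
      Q : ℕ
      Q = (q ℕ.^ k) ℕ.^ a
      Q>0 : 0 ℕ.< Q
      Q>0 = ℕP.m^n>0 (q ℕ.^ k) {{ℕP.m^n≢0 q k}} a
      t : Fin k → Vec (N ℕ.+ a)
      t = Subspace.basis T
      A : Fin (suc lam) → Matrix N a
      A i = decode (f i)
      t∈ : ∀ i j → t j ∈ₛ block (A i)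
      t∈ i j = T⊆ i (t j) (basis-member T j)
      X : Fin k → Vec N
      X j = left (t j)
      solves : ∀ i l → Solves X (λ j → t j (N ↑ʳ l)) (A i l)
      solves i l j = sym (block-coordinates (A i) (t j) (t∈ i j) l)
      X-independent : LinearlyIndependent X
      X-independent cs relation = Subspace.indep T cs (relation-lifts (A zero) t (t∈ zero) cs relation)
      open FreeCoordinates (free-coordinates N k X X-independent)
      g : Fin (suc lam) → Matrix k a → Matrix N a
      g i C l = fill (A i l) (C l)
      g-injective : ∀ {i i' C C'} → g i C ≈ₘ g i' C' → (i ≡ i') × (C ≈ₘ C')
      g-injective {i} {i'} {C} {C'} same =
        f-injective i i' (decode-injective _ _ (λ l → proj₁ (columns l))) , (λ l → proj₂ (columns l))
        where
        columns : ∀ l → (A i l ≋ A i' l) × (C l ≋ C' l)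
        columns l = fill-injective (solves i l) (solves i' l) (same l)
      too-many : suc lam ℕ.* Q ℕ.≤ (q ℕ.^ N) ℕ.^ a
      too-many = count-injection g g-injective

    packing : Packing (N ℕ.+ a) N k lam ((q ℕ.^ N) ℕ.^ a)
    packing = record
      { block    = λ b → block (decode b)
      ; distinct = λ b b' same → decode-injective b b' (block-injective _ _ same)
      ; packing  = at-most-λ-blocks
      }

open import Data.Nat using (_+_; _*_; _∸_; _^_; _≤_)
open import Data.Nat.Primality using (Prime)

-- With k = n - 2a and N = k + a the blocks above have dimension N = n - a in
-- F^(N+a) = F^n, t = k = n - 2a, and there are (q^N)^a = q^(a(n-a)) of them.
corollary5 : ∀ {c ℓ : Level} (q : ℕ) →
    Σ ℕ (λ p → Σ ℕ (λ e → Prime p × q ≡ p ^ suc e)) →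
    (F : FiniteField c ℓ q) → (a n : ℕ) → 1 ≤ a → 2 * a + 1 ≤ n →
    Σ ℕ (λ m → (q ^ (a * (n ∸ a)) ≤ m) ×
    LinAlg.Packing F n (n ∸ a) (n ∸ 2 * a) (q ^ (a * a)) m)
corollary5 q _ F a n _ 2a+1≤n =
  (q ^ N) ^ a , ℕP.≤-reflexive size , Packing-cong F N+a≡n N≡n∸a P.refl (OverField.Blocks.packing F k a)
  where
  k = n ∸ 2 * a
  N = k + a
  N+a≡n : N + a ≡ n
  N+a≡n = P.trans (ℕP.+-assoc k a a) (P.trans (P.cong (λ t → k + (a + t)) (P.sym (ℕP.+-identityʳ a)))
           (ℕP.m∸n+n≡m (ℕP.≤-trans (ℕP.m≤m+n (2 * a) 1) 2a+1≤n)))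
  N≡n∸a : N ≡ n ∸ a
  N≡n∸a = P.trans (P.sym (ℕP.m+n∸n≡m N a)) (P.cong (_∸ a) N+a≡n)
  size : q ^ (a * (n ∸ a)) ≡ (q ^ N) ^ a
  size = P.trans (P.cong (λ d → q ^ (a * d)) (P.sym N≡n∸a))
           (P.trans (P.cong (q ^_) (ℕP.*-comm a N)) (P.sym (ℕP.^-*-assoc q N a)))
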